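{- For any finite binary trees $t_1$ and $t_2$, $t_1$ is a subterm of $t_2$ if and only if $\widetilde{t_1}\,R\,\widetilde{t_2}$.
   Context: Finite binary trees are the variable-free terms built from a constant $\bot$ and a binary function symbol $\langle\cdot,\cdot\rangle$; $s$ is a subterm of $t$ iff $s=t$, or $t=\langle t',t''\rangle$ and $s$ is a subterm of $t'$ or of $t''$. For a tree $t$ let $\widehat t$ be its Polish notation string over $\{a,b\}$: $\widehat{\bot}=a$, $\widehat{\langle t_1,t_2\rangle}=b\,\widehat{t_1}\,\widehat{t_2}$. The snake $\tilde t$: if $\widehat t=a$ then $\tilde t=(0)$; if $\widehat t=\alpha_1\cdots\alpha_n$ with $n>1$ then $\tilde t=(x_1,\dots,x_n)$ with $x_1=2$ and $x_{i+1}=x_i-1$ if $\alpha_{i+1}=a$, $x_{i+1}=x_i+1$ if $\alpha_{i+1}=b$. For snakes $(x_1,\dots,x_n)$, $(y_1,\dots,y_m)$: $(x_1,\dots,x_n)$ is isomorphic with a strict part of $(y_1,\dots,y_m)$ if there are natural numbers $k,\ell$ (with all indices below lying in $\{1,\dots,m\}$) such that $y_{k+1}=y_k+1$, $y_{k+i}=x_i+\ell$ for $i=1,\dots,n$, and $y_{k+n}+2=y_{k+1}$. The relation $(x_1,\dots,x_n)\,R\,(y_1,\dots,y_m)$ holds iff $(x_1,\dots,x_n)=(0)$, or $(x_1,\dots,x_n)=(y_1,\dots,y_m)$, or $(x_1,\dots,x_n)$ is isomorphic with a strict part of $(y_1,\dots,y_m)$. -}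

module Defs where

open import Data.Nat using (ℕ; zero; suc; _≤_; _+_)
open import Data.Integer as ℤ using (ℤ; +_)
open import Data.List using (List; []; _∷_; _++_; length)
open import Data.Product using (Σ; _×_; ∃; ∃-syntax)
open import Data.Sum using (_⊎_)
open import Relation.Binary.PropositionalEquality using (_≡_)

-- finite binary trees: terms over constant ⊥ and binary ⟨_,_⟩
data Tree : Set where
  leaf : Tree
  node : Tree → Tree → Tree

data Subterm : Tree → Tree → Set where
  here  : ∀ {t} → Subterm t t
  left  : ∀ {s t′ t″} → Subterm s t′ → Subterm s (node t′ t″)
  right : ∀ {s t′ t″} → Subterm s t″ → Subterm s (node t′ t″)

data AB : Set where
  a b : AB

polish : Tree → List AB
polish leaf = a ∷ []
polish (node t₁ t₂) = b ∷ (polish t₁ ++ polish t₂)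

snakeFrom : ℤ → List AB → List ℤ
snakeFrom x [] = []
snakeFrom x (a ∷ αs) = let y = x ℤ.- ℤ.1ℤ in y ∷ snakeFrom y αs
snakeFrom x (b ∷ αs) = let y = x ℤ.+ ℤ.1ℤ in y ∷ snakeFrom y αs

snakeOfString : List AB → List ℤ
snakeOfString (a ∷ []) = (+ 0) ∷ []
snakeOfString [] = []                     -- never arises (Polish strings are nonempty)
snakeOfString (α ∷ αs) = (+ 2) ∷ snakeFrom (+ 2) αs

snake : Tree → List ℤ
snake t = snakeOfString (polish t)

-- 1-based indexing: the i-th entry of a sequence is v
_at_≡_ : List ℤ → ℕ → ℤ → Set
[] at i ≡ v = Data.Empty.⊥
  where import Data.Empty
(x ∷ xs) at zero ≡ v = Data.Empty.⊥
  where import Data.Empty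
(x ∷ xs) at suc zero ≡ v = x ≡ v
(x ∷ xs) at suc (suc i) ≡ v = xs at suc i ≡ v

StrictPart : List ℤ → List ℤ → Set
StrictPart xs ys =
  ∃[ k ] ∃[ ℓ ]
    ( 1 ≤ k × k + length xs ≤ length ys
    × (∃[ yk ] (ys at k ≡ yk × ys at suc k ≡ (yk ℤ.+ ℤ.1ℤ)))
    × (∀ i → 1 ≤ i → i ≤ length xs → ∀ xi → xs at i ≡ xi → ys at (k + i) ≡ (xi ℤ.+ (+ ℓ)))
    × (∃[ ykn ] (ys at (k + length xs) ≡ ykn × ys at suc k ≡ (ykn ℤ.+ (+ 2)))) )

R : List ℤ → List ℤ → Set
R xs ys = (xs ≡ (+ 0) ∷ []) ⊎ (xs ≡ ys) ⊎ StrictPart xs ys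

-- Read a Polish word as a walk on ℤ, b one step up and a one step down: snake t is the walk from
-- height 1 along polish t, and the word of any tree lowers the height by exactly one.  A subterm s
-- of t is an infix occurrence of polish s in polish t whose prefix does not end below its start.
-- If s is proper, the prefix is nonempty and ends at some height 1 + ℓ, so snake t contains the
-- walk of s from 1 + ℓ, i.e. snake s lifted by ℓ, entered by a step up and ending two below its
-- first entry.  Conversely the walk determines the word, so a lifted copy of snake s in snake t is
-- an infix occurrence of polish s in polish t, and by unique readability of Polish notation every
-- such occurrence is a subterm.
module Submission where

open import Defs
open import Function.Bundles using (_⇔_; mk⇔)
open import Data.Nat using (ℕ; zero; suc; _≤_; _<_; s≤s; z≤n)
import Data.Nat as ℕ
import Data.Nat.Properties as ℕP
open import Data.Integer as ℤ using (ℤ; +_; 1ℤ)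
import Data.Integer.Properties as ℤP
open import Algebra.Properties.AbelianGroup ℤP.+-0-abelianGroup using (∙-cancelˡ; ∙-cancelʳ)
open import Algebra.Properties.CommutativeSemigroup ℤP.+-commutativeSemigroup using (xy∙z≈xz∙y)
open import Data.List using (List; []; _∷_; _++_; _∷ʳ_; length; map; take; drop; concatMap)
open import Data.List.Properties
  using (++-assoc; ++-identityʳ; length-++; length-++-≤ˡ; length-map; ∷-injectiveˡ; ∷-injectiveʳ; take++drop≡id)
open import Data.List.Relation.Unary.Any using (Any; here; there)
open import Data.List.Relation.Unary.Any.Properties using (singleton⁻)
open import Data.Product using (_×_; _,_; ∃-syntax)
open import Data.Sum using (inj₁; inj₂)
open import Data.Empty using (⊥-elim)
open import Relation.Nullary using (¬_)
open import Relation.Binary.PropositionalEquality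

step : ℤ → AB → ℤ
step x a = x ℤ.- 1ℤ
step x b = x ℤ.+ 1ℤ

endHeight : ℤ → List AB → ℤ
endHeight x [] = x
endHeight x (α ∷ w) = endHeight (step x α) w

snakeFrom-∷ : ∀ x α w → snakeFrom x (α ∷ w) ≡ step x α ∷ snakeFrom (step x α) w
snakeFrom-∷ x a w = refl
snakeFrom-∷ x b w = refl

step-injective : ∀ x α β → step x α ≡ step x β → α ≡ β
step-injective x a a _ = refl
step-injective x b b _ = refl
step-injective x a b e with () ← ∙-cancelˡ x _ _ e
step-injective x b a e with () ← ∙-cancelˡ x _ _ e

step-+ : ∀ x d α → step (x ℤ.+ d) α ≡ step x α ℤ.+ d
step-+ x d a = xy∙z≈xz∙y x d (ℤ.- 1ℤ)
step-+ x d b = xy∙z≈xz∙y x d 1ℤ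

up-down : ∀ x → (x ℤ.+ 1ℤ) ℤ.- 1ℤ ≡ x
up-down x = trans (ℤP.+-assoc x 1ℤ (ℤ.- 1ℤ)) (ℤP.+-identityʳ x)

endHeight-++ : ∀ x u v → endHeight x (u ++ v) ≡ endHeight (endHeight x u) v
endHeight-++ x [] v = refl
endHeight-++ x (α ∷ u) v = endHeight-++ (step x α) u v

snakeFrom-++ : ∀ x u v → snakeFrom x (u ++ v) ≡ snakeFrom x u ++ snakeFrom (endHeight x u) v
snakeFrom-++ x [] v = refl
snakeFrom-++ x (a ∷ u) v = cong (step x a ∷_) (snakeFrom-++ (step x a) u v)
snakeFrom-++ x (b ∷ u) v = cong (step x b ∷_) (snakeFrom-++ (step x b) u v)

snakeFrom-last : ∀ x α w → ∃[ C ] snakeFrom x (α ∷ w) ≡ C ∷ʳ endHeight x (α ∷ w)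
snakeFrom-last x α [] = [] , snakeFrom-∷ x α []
snakeFrom-last x α (β ∷ w) with C , e ← snakeFrom-last (step x α) β w =
  step x α ∷ C , trans (snakeFrom-∷ x α (β ∷ w)) (cong (step x α ∷_) e)

snakeFrom-+ : ∀ x d w → map (ℤ._+ d) (snakeFrom x w) ≡ snakeFrom (x ℤ.+ d) w
snakeFrom-+ x d [] = refl
snakeFrom-+ x d (α ∷ w) = begin
  map (ℤ._+ d) (snakeFrom x (α ∷ w))
    ≡⟨ cong (map (ℤ._+ d)) (snakeFrom-∷ x α w) ⟩
  step x α ℤ.+ d ∷ map (ℤ._+ d) (snakeFrom (step x α) w)
    ≡⟨ cong (step x α ℤ.+ d ∷_) (snakeFrom-+ (step x α) d w) ⟩
  step x α ℤ.+ d ∷ snakeFrom (step x α ℤ.+ d) w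
    ≡⟨ cong (λ y → y ∷ snakeFrom y w) (sym (step-+ x d α)) ⟩
  step (x ℤ.+ d) α ∷ snakeFrom (step (x ℤ.+ d) α) w
    ≡⟨ sym (snakeFrom-∷ (x ℤ.+ d) α w) ⟩
  snakeFrom (x ℤ.+ d) (α ∷ w) ∎
  where open ≡-Reasoning

snakeFrom-prefix : ∀ x u v post → snakeFrom x u ≡ snakeFrom x v ++ post → ∃[ q ] u ≡ v ++ q
snakeFrom-prefix x u [] post e = u , refl
snakeFrom-prefix x [] (a ∷ v) post ()
snakeFrom-prefix x [] (b ∷ v) post ()
snakeFrom-prefix x (α ∷ u) (β ∷ v) post e
  rewrite snakeFrom-∷ x α u | snakeFrom-∷ x β v
  with refl ← step-injective x α β (∷-injectiveˡ e)
  with q , refl ← snakeFrom-prefix (step x α) u v post (∷-injectiveʳ e)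
  = q , refl

drop-snakeFrom : ∀ k x w → drop k (snakeFrom x w) ≡ snakeFrom (endHeight x (take k w)) (drop k w)
drop-snakeFrom zero x w = refl
drop-snakeFrom (suc k) x [] = refl
drop-snakeFrom (suc k) x (a ∷ w) = drop-snakeFrom k (step x a) w
drop-snakeFrom (suc k) x (b ∷ w) = drop-snakeFrom k (step x b) w

endHeight-take : ∀ j x w {y} → snakeFrom x w at suc j ≡ y → endHeight x (take (suc j) w) ≡ y
endHeight-take j x [] ()
endHeight-take zero x (a ∷ w) h = h
endHeight-take zero x (b ∷ w) h = h
endHeight-take (suc j) x (a ∷ w) h = endHeight-take j (step x a) w h
endHeight-take (suc j) x (b ∷ w) h = endHeight-take j (step x b) w h

endHeight-polish : ∀ x t → endHeight x (polish t) ≡ x ℤ.- 1ℤ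
endHeight-polish x leaf = refl
endHeight-polish x (node t₁ t₂) = begin
  endHeight (x ℤ.+ 1ℤ) (polish t₁ ++ polish t₂)
    ≡⟨ endHeight-++ (x ℤ.+ 1ℤ) (polish t₁) (polish t₂) ⟩
  endHeight (endHeight (x ℤ.+ 1ℤ) (polish t₁)) (polish t₂)
    ≡⟨ cong (λ y → endHeight y (polish t₂)) (trans (endHeight-polish (x ℤ.+ 1ℤ) t₁) (up-down x)) ⟩
  endHeight x (polish t₂)
    ≡⟨ endHeight-polish x t₂ ⟩
  x ℤ.- 1ℤ ∎
  where open ≡-Reasoning

snake≡snakeFrom : ∀ t → snake t ≡ snakeFrom (+ 1) (polish t)
snake≡snakeFrom leaf = refl
snake≡snakeFrom (node t₁ t₂) = refl

at-∷⁻ : ∀ {z zs n v} → 1 ≤ n → (z ∷ zs) at suc n ≡ v → zs at n ≡ v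
at-∷⁻ {n = suc n} _ h = h

at-∷⁺ : ∀ {z zs n v} → 1 ≤ n → zs at n ≡ v → (z ∷ zs) at suc n ≡ v
at-∷⁺ {n = suc n} _ h = h

at-functional : ∀ zs i {v w} → zs at i ≡ v → zs at i ≡ w → v ≡ w
at-functional [] i ()
at-functional (z ∷ zs) zero ()
at-functional (z ∷ zs) (suc zero) h h′ = trans (sym h) h′
at-functional (z ∷ zs) (suc (suc i)) h h′ = at-functional zs (suc i) h h′

1≤+suc : ∀ m n → 1 ≤ m ℕ.+ suc n
1≤+suc m n = ℕP.n≢0⇒n>0 (ℕP.m+1+n≢0 m)

at-++ʳ : ∀ A {zs i v} → zs at suc i ≡ v → (A ++ zs) at (length A ℕ.+ suc i) ≡ v
at-++ʳ [] h = h
at-++ʳ (z ∷ A) {i = i} h = at-∷⁺ (1≤+suc (length A) i) (at-++ʳ A h)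

at-drop : ∀ k {zs i v} → zs at (k ℕ.+ suc i) ≡ v → drop k zs at suc i ≡ v
at-drop zero h = h
at-drop (suc k) {[]} ()
at-drop (suc k) {z ∷ zs} {i} h = at-drop k (at-∷⁻ (1≤+suc k i) h)

at-map-++ : ∀ xs B (f : ℤ → ℤ) {i v} → xs at i ≡ v → (map f xs ++ B) at i ≡ f v
at-map-++ [] B f ()
at-map-++ (x ∷ xs) B f {zero} ()
at-map-++ (x ∷ xs) B f {suc zero} h = cong f h
at-map-++ (x ∷ xs) B f {suc (suc i)} h = at-map-++ xs B f h

at-last : ∀ C z → (C ∷ʳ z) at length (C ∷ʳ z) ≡ z
at-last C z = subst (λ n → (C ∷ʳ z) at n ≡ z) (sym (length-++ C)) (at-++ʳ C refl)

map-prefix : ∀ xs zs (f : ℤ → ℤ) →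
  (∀ i → i < length xs → ∀ xi → xs at suc i ≡ xi → zs at suc i ≡ f xi) →
  ∃[ post ] zs ≡ map f xs ++ post
map-prefix [] zs f entries = zs , refl
map-prefix (x ∷ xs) [] f entries = ⊥-elim (entries 0 (s≤s z≤n) x refl)
map-prefix (x ∷ xs) (z ∷ zs) f entries
  with post , e ← map-prefix xs zs f (λ i i<n → entries (suc i) (s≤s i<n)) =
  post , cong₂ _∷_ (entries 0 (s≤s z≤n) x refl) e

window⇒drop : ∀ k xs ys (f : ℤ → ℤ) →
  (∀ i → 1 ≤ i → i ≤ length xs → ∀ xi → xs at i ≡ xi → ys at (k ℕ.+ i) ≡ f xi) →
  ∃[ post ] drop k ys ≡ map f xs ++ post
window⇒drop k xs ys f window =
  map-prefix xs (drop k ys) f (λ i i<n xi h → at-drop k (window (suc i) (s≤s z≤n) i<n xi h))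

-- Unique readability of Polish notation

polish-prefixFree : ∀ t s {u v} → polish t ++ u ≡ polish s ++ v → t ≡ s × u ≡ v
polish-prefixFree leaf leaf e = refl , ∷-injectiveʳ e
polish-prefixFree leaf (node _ _) ()
polish-prefixFree (node _ _) leaf ()
polish-prefixFree (node t₁ t₂) (node s₁ s₂) {u} {v} e
  with refl , e₂ ← polish-prefixFree t₁ s₁
                     (trans (sym (++-assoc (polish t₁) (polish t₂) u))
                            (trans (∷-injectiveʳ e) (++-assoc (polish s₁) (polish s₂) v)))
  with refl , e₃ ← polish-prefixFree t₂ s₂ e₂
  = refl , e₃

infix⇒any-subterm : ∀ s p ts q → concatMap polish ts ≡ p ++ polish s ++ q → Any (Subterm s) ts
infix⇒any-subterm leaf [] [] q ()
infix⇒any-subterm (node _ _) [] [] q ()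
infix⇒any-subterm s [] (t ∷ ts) q e with refl , _ ← polish-prefixFree t s e = here here
infix⇒any-subterm s (α ∷ p) [] q ()
infix⇒any-subterm s (α ∷ p) (leaf ∷ ts) q e = there (infix⇒any-subterm s p ts q (∷-injectiveʳ e))
infix⇒any-subterm s (α ∷ p) (node t₁ t₂ ∷ ts) q e
  with infix⇒any-subterm s p (t₁ ∷ t₂ ∷ ts) q
         (trans (sym (++-assoc (polish t₁) (polish t₂) _)) (∷-injectiveʳ e))
... | here h = here (left h)
... | there (here h) = here (right h)
... | there (there h) = there h

infix⇒subterm : ∀ {s t} p q → polish t ≡ p ++ polish s ++ q → Subterm s t
infix⇒subterm {s} {t} p q e =
  singleton⁻ (infix⇒any-subterm s p (t ∷ []) q (trans (++-identityʳ (polish t)) e))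

-- Subterms give strict parts

strictPart-intro : ∀ A B y x xs z ℓ →
  y ℤ.+ 1ℤ ≡ x ℤ.+ + ℓ → (x ∷ xs) at length (x ∷ xs) ≡ z → x ≡ z ℤ.+ + 2 →
  StrictPart (x ∷ xs) (A ++ y ∷ map (ℤ._+ + ℓ) (x ∷ xs) ++ B)
strictPart-intro A B y x xs z ℓ entry last-z x≡z+2 =
  k , ℓ , ℕP.m≤n+m 1 (length A) , length-bound ,
  (y , at-++ʳ A refl , next) ,
  window ,
  (z ℤ.+ + ℓ , window n (s≤s z≤n) ℕP.≤-refl z last-z , subst (λ v → ys at suc k ≡ v) drop-by-2 next)
  where
  f = ℤ._+ + ℓ
  n = length (x ∷ xs)
  zs = y ∷ map f (x ∷ xs) ++ B
  ys = A ++ zs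
  k = length A ℕ.+ 1

  at-offset : ∀ {j v} → zs at suc j ≡ v → ys at (k ℕ.+ j) ≡ v
  at-offset {j} {v} h = subst (λ m → ys at m ≡ v) (sym (ℕP.+-assoc (length A) 1 j)) (at-++ʳ A h)

  next : ys at suc k ≡ (y ℤ.+ 1ℤ)
  next = subst (λ m → ys at m ≡ (y ℤ.+ 1ℤ)) (ℕP.+-comm k 1) (at-offset {1} (sym entry))

  window : ∀ i → 1 ≤ i → i ≤ n → ∀ xi → (x ∷ xs) at i ≡ xi → ys at (k ℕ.+ i) ≡ f xi
  window (suc i) _ _ xi h = at-offset {suc i} (at-map-++ (x ∷ xs) B f {suc i} h)

  drop-by-2 : y ℤ.+ 1ℤ ≡ f z ℤ.+ + 2
  drop-by-2 = trans entry (trans (cong f x≡z+2) (xy∙z≈xz∙y z (+ 2) (+ ℓ)))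

  length-bound : k ℕ.+ n ≤ length ys
  length-bound = begin
    k ℕ.+ n               ≡⟨ ℕP.+-assoc (length A) 1 n ⟩
    length A ℕ.+ suc n     ≤⟨ ℕP.+-monoʳ-≤ (length A) (s≤s n≤) ⟩
    length A ℕ.+ length zs ≡⟨ length-++ A ⟨
    length ys              ∎
    where
    open ℕP.≤-Reasoning
    n≤ : n ≤ length (map f (x ∷ xs) ++ B)
    n≤ = ℕP.≤-trans (ℕP.≤-reflexive (sym (length-map f (x ∷ xs)))) (length-++-≤ˡ (map f (x ∷ xs)))

-- The depth becomes the offset ℓ of StrictPart, which has to be a natural number.
record Occurrence (x : ℤ) (s t : Tree) : Set where
  constructor occurrence
  field
    prefix suffix : List AB
    depth : ℕ
    splits : polish t ≡ prefix ++ polish s ++ suffix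
    height : endHeight x prefix ≡ x ℤ.+ + depth

occurrence-left : ∀ {x s t₁ t₂} → Occurrence (x ℤ.+ 1ℤ) s t₁ → Occurrence x s (node t₁ t₂)
occurrence-left {x} {s} {t₁} {t₂} (occurrence u v d splits height) =
  occurrence (b ∷ u) (v ++ polish t₂) (suc d) (cong (b ∷_) splits′)
    (trans height (ℤP.+-assoc x 1ℤ (+ d)))
  where
  splits′ : polish t₁ ++ polish t₂ ≡ u ++ polish s ++ v ++ polish t₂
  splits′ = begin
    polish t₁ ++ polish t₂                 ≡⟨ cong (_++ polish t₂) splits ⟩
    (u ++ polish s ++ v) ++ polish t₂       ≡⟨ ++-assoc u (polish s ++ v) (polish t₂) ⟩
    u ++ (polish s ++ v) ++ polish t₂       ≡⟨ cong (u ++_) (++-assoc (polish s) v (polish t₂)) ⟩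
    u ++ polish s ++ v ++ polish t₂ ∎
    where open ≡-Reasoning

occurrence-right : ∀ {x s t₁ t₂} → Occurrence x s t₂ → Occurrence x s (node t₁ t₂)
occurrence-right {x} {s} {t₁} {t₂} (occurrence u v d splits height) =
  occurrence (b ∷ polish t₁ ++ u) v d (cong (b ∷_) splits′) height′
  where
  splits′ : polish t₁ ++ polish t₂ ≡ (polish t₁ ++ u) ++ polish s ++ v
  splits′ = trans (cong (polish t₁ ++_) splits) (sym (++-assoc (polish t₁) u (polish s ++ v)))

  height′ : endHeight (x ℤ.+ 1ℤ) (polish t₁ ++ u) ≡ x ℤ.+ + d
  height′ = begin
    endHeight (x ℤ.+ 1ℤ) (polish t₁ ++ u)
      ≡⟨ endHeight-++ (x ℤ.+ 1ℤ) (polish t₁) u ⟩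
    endHeight (endHeight (x ℤ.+ 1ℤ) (polish t₁)) u
      ≡⟨ cong (λ y → endHeight y u) (trans (endHeight-polish (x ℤ.+ 1ℤ) t₁) (up-down x)) ⟩
    endHeight x u
      ≡⟨ height ⟩
    x ℤ.+ + d ∎
    where open ≡-Reasoning

subterm⇒occurrence : ∀ {s t} → Subterm s t → ∀ x → Occurrence x s t
subterm⇒occurrence here x = occurrence [] [] 0 (sym (++-identityʳ _)) (sym (ℤP.+-identityʳ x))
subterm⇒occurrence (left p) x = occurrence-left (subterm⇒occurrence p (x ℤ.+ 1ℤ))
subterm⇒occurrence (right p) x = occurrence-right (subterm⇒occurrence p x)

snake-last : ∀ s₁ s₂ → snake (node s₁ s₂) at length (snake (node s₁ s₂)) ≡ (+ 0)
snake-last s₁ s₂ with C , e ← snakeFrom-last (+ 1) b (polish s₁ ++ polish s₂) =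
  subst (λ zs → zs at length zs ≡ (+ 0)) (sym ends-at-0) (at-last C (+ 0))
  where
  ends-at-0 : snake (node s₁ s₂) ≡ C ∷ʳ + 0
  ends-at-0 = trans e (cong (C ∷ʳ_) (endHeight-polish (+ 1) (node s₁ s₂)))

occurrence⇒strictPart : ∀ {s₁ s₂ t} (o : Occurrence (+ 1) (node s₁ s₂) t) →
  ¬ Occurrence.prefix o ≡ [] → StrictPart (snake (node s₁ s₂)) (snake t)
occurrence⇒strictPart (occurrence [] _ _ _ _) nonempty = ⊥-elim (nonempty refl)
occurrence⇒strictPart {s₁} {s₂} {t} (occurrence (α ∷ u) v d splits height) _
  with C , snake-prefix ← snakeFrom-last (+ 1) α u =
  subst (StrictPart (snake s)) (sym snake-t)
    (strictPart-intro C B (+ suc d) (+ 2) (snakeFrom (+ 2) (polish s₁ ++ polish s₂)) (+ 0) d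
      (ℤP.+-comm (+ suc d) 1ℤ) (snake-last s₁ s₂) refl)
  where
  s = node s₁ s₂
  B = snakeFrom (endHeight (+ suc d) (polish s)) v
  snake-t : snake t ≡ C ++ + suc d ∷ map (ℤ._+ + d) (snake s) ++ B
  snake-t = begin
    snake t
      ≡⟨ snake≡snakeFrom t ⟩
    snakeFrom (+ 1) (polish t)
      ≡⟨ cong (snakeFrom (+ 1)) splits ⟩
    snakeFrom (+ 1) ((α ∷ u) ++ polish s ++ v)
      ≡⟨ snakeFrom-++ (+ 1) (α ∷ u) (polish s ++ v) ⟩
    snakeFrom (+ 1) (α ∷ u) ++ snakeFrom (endHeight (+ 1) (α ∷ u)) (polish s ++ v)
      ≡⟨ cong₂ (λ zs y → zs ++ snakeFrom y (polish s ++ v)) (trans snake-prefix (cong (C ∷ʳ_) height)) height ⟩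
    (C ∷ʳ + suc d) ++ snakeFrom (+ suc d) (polish s ++ v)
      ≡⟨ ++-assoc C (+ suc d ∷ []) _ ⟩
    C ++ + suc d ∷ snakeFrom (+ suc d) (polish s ++ v)
      ≡⟨ cong (λ zs → C ++ + suc d ∷ zs) (snakeFrom-++ (+ suc d) (polish s) v) ⟩
    C ++ + suc d ∷ snakeFrom (+ suc d) (polish s) ++ B
      ≡⟨ cong (λ zs → C ++ + suc d ∷ zs ++ B) (snakeFrom-+ (+ 1) (+ d) (polish s)) ⟨
    C ++ + suc d ∷ map (ℤ._+ + d) (snake s) ++ B ∎
    where open ≡-Reasoning

subterm⇒R : ∀ {s t} → Subterm s t → R (snake s) (snake t)
subterm⇒R {leaf} _ = inj₁ refl
subterm⇒R {node _ _} here = inj₂ (inj₁ refl)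
subterm⇒R {node _ _} (left p) =
  inj₂ (inj₂ (occurrence⇒strictPart (occurrence-left (subterm⇒occurrence p _)) λ ()))
subterm⇒R {node _ _} (right p) =
  inj₂ (inj₂ (occurrence⇒strictPart (occurrence-right (subterm⇒occurrence p _)) λ ()))

-- Strict parts give subterms

strictPart⇒subterm : ∀ s₁ s₂ t → StrictPart (snake (node s₁ s₂)) (snake t) → Subterm (node s₁ s₂) t
strictPart⇒subterm s₁ s₂ t (zero , _ , () , _)
strictPart⇒subterm s₁ s₂ t (suc j , ℓ , _ , _ , (y , at-k , at-suc-k) , window , _) =
  let post , drop-window = window⇒drop (suc j) (snake s) (snake t) (ℤ._+ + ℓ) window
      q , rest = snakeFrom-prefix (+ suc ℓ) (drop (suc j) w) (polish s) post (rest-snake drop-window)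
  in infix⇒subterm (take (suc j) w) q
       (trans (sym (take++drop≡id (suc j) w)) (cong (take (suc j) w ++_) rest))
  where
  s = node s₁ s₂
  w = polish t

  first-in-window : snake t at suc (suc j) ≡ (+ 2 ℤ.+ + ℓ)
  first-in-window = subst (λ m → snake t at m ≡ (+ 2 ℤ.+ + ℓ)) (ℕP.+-comm (suc j) 1)
                      (window 1 (s≤s z≤n) (s≤s z≤n) (+ 2) refl)

  y≡1+ℓ : y ≡ + suc ℓ
  y≡1+ℓ = ∙-cancelʳ 1ℤ y (+ suc ℓ)
    (trans (at-functional (snake t) (suc (suc j)) at-suc-k first-in-window) (ℤP.+-comm 1ℤ (+ suc ℓ)))

  entry-height : endHeight (+ 1) (take (suc j) w) ≡ + suc ℓ
  entry-height =
    trans (endHeight-take j (+ 1) w (subst (λ zs → zs at suc j ≡ y) (snake≡snakeFrom t) at-k)) y≡1+ℓ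

  rest-snake : ∀ {post} → drop (suc j) (snake t) ≡ map (ℤ._+ + ℓ) (snake s) ++ post →
    snakeFrom (+ suc ℓ) (drop (suc j) w) ≡ snakeFrom (+ suc ℓ) (polish s) ++ post
  rest-snake {post} drop-window = begin
    snakeFrom (+ suc ℓ) (drop (suc j) w)
      ≡⟨ cong (λ x → snakeFrom x (drop (suc j) w)) entry-height ⟨
    snakeFrom (endHeight (+ 1) (take (suc j) w)) (drop (suc j) w)
      ≡⟨ drop-snakeFrom (suc j) (+ 1) w ⟨
    drop (suc j) (snakeFrom (+ 1) w)
      ≡⟨ cong (drop (suc j)) (snake≡snakeFrom t) ⟨
    drop (suc j) (snake t)
      ≡⟨ drop-window ⟩
    map (ℤ._+ + ℓ) (snake s) ++ post
      ≡⟨ cong (_++ post) (snakeFrom-+ (+ 1) (+ ℓ) (polish s)) ⟩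
    snakeFrom (+ suc ℓ) (polish s) ++ post ∎
    where open ≡-Reasoning

leaf-subterm : ∀ t → Subterm leaf t
leaf-subterm leaf = here
leaf-subterm (node t₁ t₂) = left (leaf-subterm t₁)

R⇒subterm : ∀ s t → R (snake s) (snake t) → Subterm s t
R⇒subterm leaf t _ = leaf-subterm t
R⇒subterm (node s₁ s₂) t (inj₁ ())
R⇒subterm s@(node _ _) t (inj₂ (inj₁ snake-s≡snake-t))
  with q , splits ← snakeFrom-prefix (+ 1) (polish t) (polish s) []
                      (trans (sym (snake≡snakeFrom t)) (trans (sym snake-s≡snake-t) (sym (++-identityʳ _))))
  = infix⇒subterm [] q splits
R⇒subterm (node s₁ s₂) t (inj₂ (inj₂ strictPart)) = strictPart⇒subterm s₁ s₂ t strictPart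

lemma11 : (t₁ t₂ : Tree) → Subterm t₁ t₂ ⇔ R (snake t₁) (snake t₂)
lemma11 t₁ t₂ = mk⇔ subterm⇒R (R⇒subterm t₁ t₂)
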